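{- Let $A$ be a set of at least four alternatives, let $\mathcal D\subseteq\mathcal L(A)$ be a domain and let $a\in A$. Then (a) if $\mathcal D$ is connected, then $\mathcal D_{ -a}$ is connected; (b) if $\mathcal D$ is directly connected, then $\mathcal D_{ -a}$ is directly connected.
   Context: $A$ is finite; $\mathcal L(A)$ is the set of linear orders on $A$ and a domain is any subset of it. $\mathcal D_{ -a}=\{R_{A\setminus\{a\}}:R\in\mathcal D\}$, where $R_{A\setminus\{a\}}$ is the restriction of $R$ to $A\setminus\{a\}$. Two linear orders are alike if one is obtained from the other by swapping two alternatives in adjacent positions. A path connecting $R$ and $T$ is a sequence $(R_1,\dots,R_k)$ with $R_1=R$, $R_k=T$ and consecutive orders alike; a geodesic is a path connecting $R$ and $T$ of minimum length. A domain is connected if every two of its orders are connected by a path whose orders all lie in the domain, and directly connected if every two of its orders are connected by a geodesic whose orders all lie in the domain. -}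

module Defs where

open import Data.Nat using (ℕ; suc; _≤_)
open import Data.List using (List; []; _∷_; _++_; filter; length)
open import Data.List.Relation.Unary.Unique.Propositional using (Unique)
open import Data.List.Relation.Binary.Permutation.Propositional using (_↭_)
open import Data.Product using (Σ; ∃; _×_; _,_)
open import Relation.Binary.Definitions using (DecidableEquality)
open import Relation.Binary.PropositionalEquality using (_≡_)
open import Relation.Nullary using (¬?)

-- Alternatives live in a type X with decidable equality; the finite set of
-- alternatives A is a duplicate-free list of elements of X.
-- A linear order on A is a list enumerating A from best to worst,
-- i.e. a permutation of A.
LinOrd : {X : Set} → List X → List X → Set
LinOrd A R = R ↭ A

IsDomain : {X : Set} → List X → (List X → Set) → Set
IsDomain A D = ∀ R → D R → LinOrd A R

Alike : {X : Set} → List X → List X → Set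
Alike {X} R T = Σ (List X) λ xs → Σ X λ x → Σ X λ y → Σ (List X) λ ys →
  (R ≡ xs ++ x ∷ y ∷ ys) × (T ≡ xs ++ y ∷ x ∷ ys)

-- Path P R T k : a path (R₁,…,R_k) with R₁ = R, R_k = T, consecutive orders
-- alike, all orders satisfying P; k is the number of orders (its length).
data Path {X : Set} (P : List X → Set) : List X → List X → ℕ → Set where
  here : ∀ {R} → P R → Path P R R 1
  step : ∀ {R S T k} → P R → Alike R S → Path P S T k → Path P R T (suc k)

remove : {X : Set} → DecidableEquality X → X → List X → List X
remove _≟_ a R = filter (λ x → ¬? (x ≟ a)) R

Restrict : {X : Set} → DecidableEquality X → X → (List X → Set) → List X → Set
Restrict {X} _≟_ a D S = Σ (List X) λ R → D R × (S ≡ remove _≟_ a R)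

Connected : {X : Set} → (List X → Set) → Set
Connected D = ∀ R T → D R → D T → ∃ λ k → Path D R T k

DirectlyConnected : {X : Set} → List X → (List X → Set) → Set
DirectlyConnected A D = ∀ R T → D R → D T →
  ∃ λ k → Path D R T k × (∀ k' → Path (LinOrd A) R T k' → k ≤ k')

{-# OPTIONS --safe #-}

-- The Kendall tau distance d (the number of inversions) increases by at most one per
-- adjacent swap, so every path from R to T has length at least 1 + d(R, T), and bubble
-- sort attains this bound: geodesics are exactly the paths of length 1 + d.  Restricting
-- a path to A ∖ {a} drops the swaps involving a, each of which removes at most one
-- inversion, and turns every other swap into a swap of the restricted orders that changes
-- d(·∖a, T∖a) exactly as it changed d(·, T).  So the restricted path lies in D₋ₐ and its
-- excess length over the distance of its endpoints is at most that of the original path;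
-- in particular geodesics restrict to geodesics.
module Submission where

open import Defs
open import Data.Nat using (ℕ; zero; suc; _+_; _≤_; z≤n; s≤s)
open import Data.Nat.Properties
open import Data.Nat.ListAction using (sum)
open import Data.Nat.ListAction.Properties using (sum-↭)
open import Data.Nat.Tactic.RingSolver using (solve-∀)
open import Algebra.Properties.CommutativeSemigroup +-commutativeSemigroup using (x∙yz≈y∙xz)
open import Data.List using (List; []; _∷_; _++_; length; map)
open import Data.List.Properties using (map-cong-local; filter-++; filter-accept; filter-reject)
open import Data.List.Relation.Unary.All as All using (All; []; _∷_)
open import Data.List.Relation.Unary.AllPairs using (_∷_)
open import Data.List.Relation.Unary.Any using (here)
open import Data.List.Relation.Unary.Unique.Propositional using (Unique)
open import Data.List.Relation.Unary.Unique.Propositional.Properties using (filter⁺)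
open import Data.List.Relation.Binary.Permutation.Propositional
  using (_↭_; ↭-refl; ↭-sym; ↭-trans; ↭-swap; ↭⇒↭ₛ)
open import Data.List.Relation.Binary.Permutation.Propositional.Properties
  using (++⁺ˡ; map⁺; shift; drop-∷; ↭-empty-inv; All-resp-↭; ∈-resp-↭)
open import Data.List.Membership.Propositional using (_∈_)
open import Data.List.Membership.Propositional.Properties using (∈-∃++)
open import Data.Product using (∃; _×_; _,_)
open import Data.Unit using (tt)
open import Data.Empty using (⊥-elim)
open import Relation.Binary.Definitions using (DecidableEquality)
open import Relation.Binary.PropositionalEquality using (_≡_; _≢_; refl; sym; trans; cong; cong₂; setoid; module ≡-Reasoning)
open import Relation.Nullary using (Dec; yes; no; ¬?)
open import Relation.Unary using (U)
open import Function using (_∘_)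

module _ {X : Set} (_≟_ : DecidableEquality X) where

  private variable
    P Q : List X → Set
    R S T : List X
    k m : ℕ

  precedes : List X → X → X → ℕ
  precedes []      x y = 0
  precedes (z ∷ T) x y with z ≟ y
  ... | yes _ = 0
  ... | no _ with z ≟ x
  ...   | yes _ = 1
  ...   | no _  = precedes T x y

  inversions : List X → List X → ℕ
  inversions []      T = 0
  inversions (x ∷ R) T = sum (map (λ y → precedes T y x) R) + inversions R T

  precedes≤1 : ∀ T x y → precedes T x y ≤ 1
  precedes≤1 []      x y = z≤n
  precedes≤1 (z ∷ T) x y with z ≟ y
  ... | yes _ = z≤n
  ... | no _ with z ≟ x
  ...   | yes _ = s≤s z≤n
  ...   | no _  = precedes≤1 T x y

  precedes-∷ : ∀ {t x y} T → t ≢ x → t ≢ y → precedes (t ∷ T) x y ≡ precedes T x y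
  precedes-∷ {t} {x} {y} T t≢x t≢y with t ≟ y
  ... | yes t≡y = ⊥-elim (t≢y t≡y)
  ... | no _ with t ≟ x
  ...   | yes t≡x = ⊥-elim (t≢x t≡x)
  ...   | no _    = refl

  head-precedes : ∀ {t y} T → t ≢ y → precedes (t ∷ T) t y ≡ 1
  head-precedes {t} {y} T t≢y with t ≟ y
  ... | yes t≡y = ⊥-elim (t≢y t≡y)
  ... | no _ with t ≟ t
  ...   | yes _   = refl
  ...   | no t≢t  = ⊥-elim (t≢t refl)

  ¬precedes-head : ∀ t T x → precedes (t ∷ T) x t ≡ 0
  ¬precedes-head t T x with t ≟ t
  ... | yes _  = refl
  ... | no t≢t = ⊥-elim (t≢t refl)

  inversions-swap : ∀ T xs x y ys →
    inversions (xs ++ x ∷ y ∷ ys) T + precedes T x y ≡ inversions (xs ++ y ∷ x ∷ ys) T + precedes T y x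
  inversions-swap T [] x y ys =
    rearrange (precedes T y x) (precedes T x y)
          (sum (map (λ z → precedes T z x) ys)) (sum (map (λ z → precedes T z y) ys)) (inversions ys T)
    where
    rearrange : ∀ a b c d e → (a + c) + (d + e) + b ≡ (b + d) + (c + e) + a
    rearrange = solve-∀
  inversions-swap T (z ∷ xs) x y ys = begin
    sum (map f L) + inversions L T + precedes T x y    ≡⟨ +-assoc (sum (map f L)) _ _ ⟩
    sum (map f L) + (inversions L T + precedes T x y)  ≡⟨ cong₂ _+_ (sum-↭ (map⁺ f (++⁺ˡ xs (↭-swap x y ↭-refl))))
                                                                    (inversions-swap T xs x y ys) ⟩
    sum (map f L′) + (inversions L′ T + precedes T y x) ≡⟨ +-assoc (sum (map f L′)) _ _ ⟨
    sum (map f L′) + inversions L′ T + precedes T y x   ∎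
    where
    open ≡-Reasoning
    f : X → ℕ
    f w = precedes T w z
    L L′ : List X
    L  = xs ++ x ∷ y ∷ ys
    L′ = xs ++ y ∷ x ∷ ys

  inversions-alike : ∀ T → Alike R S → inversions R T ≤ suc (inversions S T)
  inversions-alike T (xs , x , y , ys , refl , refl) = begin
    inversions (xs ++ x ∷ y ∷ ys) T                    ≤⟨ m≤m+n _ _ ⟩
    inversions (xs ++ x ∷ y ∷ ys) T + precedes T x y   ≡⟨ inversions-swap T xs x y ys ⟩
    inversions (xs ++ y ∷ x ∷ ys) T + precedes T y x   ≤⟨ +-monoʳ-≤ _ (precedes≤1 T y x) ⟩
    inversions (xs ++ y ∷ x ∷ ys) T + 1                ≡⟨ +-comm _ 1 ⟩
    suc (inversions (xs ++ y ∷ x ∷ ys) T)              ∎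
    where open ≤-Reasoning

  inversions-∷-fresh : ∀ {t} T R → All (t ≢_) R → inversions R (t ∷ T) ≡ inversions R T
  inversions-∷-fresh T []      []          = refl
  inversions-∷-fresh T (x ∷ R) (t≢x ∷ t∉R) =
    cong₂ _+_ (cong sum (map-cong-local (All.map (λ t≢y → precedes-∷ T t≢y t≢x) t∉R)))
              (inversions-∷-fresh T R t∉R)

  inversions-head : ∀ t T R → All (t ≢_) R → inversions (t ∷ R) (t ∷ T) ≡ inversions R T
  inversions-head t T R t∉R = cong₂ _+_ (nothing-precedes-head R) (inversions-∷-fresh T R t∉R)
    where
    nothing-precedes-head : ∀ R → sum (map (λ y → precedes (t ∷ T) y t) R) ≡ 0
    nothing-precedes-head []      = refl
    nothing-precedes-head (y ∷ R) = cong₂ _+_ (¬precedes-head t T y) (nothing-precedes-head R)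

  inversions-self≡0 : Unique T → inversions T T ≡ 0
  inversions-self≡0 {[]}    _          = refl
  inversions-self≡0 {t ∷ T} (t∉T ∷ uT) = trans (inversions-head t T T t∉T) (inversions-self≡0 uT)

  inversions-toFront : ∀ t T xs ys → All (t ≢_) (xs ++ ys) →
    inversions (xs ++ t ∷ ys) (t ∷ T) ≡ length xs + inversions (xs ++ ys) T
  inversions-toFront t T []       ys t∉ys            = inversions-head t T ys t∉ys
  inversions-toFront t T (z ∷ xs) ys (t≢z ∷ t∉rest) = begin
    sum (map f (xs ++ t ∷ ys)) + inversions (xs ++ t ∷ ys) (t ∷ T)
      ≡⟨ cong₂ _+_ (sum-↭ (map⁺ f (shift t xs ys))) (inversions-toFront t T xs ys t∉rest) ⟩
    (f t + sum (map f (xs ++ ys))) + (length xs + inversions (xs ++ ys) T)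
      ≡⟨ cong₂ (λ m n → (m + n) + _) (head-precedes T t≢z)
           (cong sum (map-cong-local (All.map (λ t≢w → precedes-∷ T t≢w t≢z) t∉rest))) ⟩
    suc (s + (length xs + inversions (xs ++ ys) T))
      ≡⟨ cong suc (x∙yz≈y∙xz s (length xs) _) ⟩
    suc (length xs + (s + inversions (xs ++ ys) T)) ∎
    where
    open ≡-Reasoning
    f : X → ℕ
    f w = precedes (t ∷ T) w z
    s : ℕ
    s = sum (map (λ w → precedes T w z) (xs ++ ys))

  Path-length≥ : Unique T → Path P R T k → suc (inversions R T) ≤ k
  Path-length≥ uT (here _) rewrite inversions-self≡0 uT = s≤s z≤n
  Path-length≥ uT (step _ R~S p) = s≤s (≤-trans (inversions-alike _ R~S) (Path-length≥ uT p))

  Path-∷ : ∀ z → Path P R T k → Path U (z ∷ R) (z ∷ T) k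
  Path-∷ z (here _)                                   = here tt
  Path-∷ z (step _ (xs , x , y , ys , refl , refl) p) = step tt (z ∷ xs , x , y , ys , refl , refl) (Path-∷ z p)

  Path-snoc : Path P R S k → Alike S T → P T → Path P R T (suc k)
  Path-snoc (here pR)       S~T pT = step pR S~T (here pT)
  Path-snoc (step pR R~V p) S~T pT = step pR R~V (Path-snoc p S~T pT)

  Path-++ : Path P R S (suc k) → Path P S T m → Path P R T (k + m)
  Path-++ (here _)                    q = q
  Path-++ (step {k = zero}  _ _ ())   q
  Path-++ (step {k = suc k} pR R~V p) q = step pR R~V (Path-++ p q)

  Alike⇒↭ : Alike R S → S ↭ R
  Alike⇒↭ (xs , x , y , ys , refl , refl) = ++⁺ˡ xs (↭-swap y x ↭-refl)

  Path-within-LinOrd : ∀ {A} → LinOrd A R → Path Q R T k → Path (LinOrd A) R T k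
  Path-within-LinOrd R∈L (here _)       = here R∈L
  Path-within-LinOrd R∈L (step _ R~S p) = step R∈L R~S (Path-within-LinOrd (↭-trans (Alike⇒↭ R~S) R∈L) p)

  Path-toFront : ∀ t xs ys → Path U (xs ++ t ∷ ys) (t ∷ xs ++ ys) (suc (length xs))
  Path-toFront t []       ys = here tt
  Path-toFront t (z ∷ xs) ys = Path-snoc (Path-∷ z (Path-toFront t xs ys)) ([] , z , t , xs ++ ys , refl , refl) tt

  bubble-sort : Unique T → R ↭ T → ∃ λ k → Path U R T k × k ≤ suc (inversions R T)
  bubble-sort {T = []} _ R↭[] rewrite ↭-empty-inv R↭[] = 1 , here tt , ≤-refl
  bubble-sort {T = t ∷ T} (t∉T ∷ uT) R↭ with xs , ys , refl ← ∈-∃++ (∈-resp-↭ (↭-sym R↭) (here refl)) =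
    let rest↭T       = drop-∷ (↭-trans (↭-sym (shift t xs ys)) R↭)
        (m , q , m≤) = bubble-sort uT rest↭T
        open ≤-Reasoning
    in length xs + m , Path-++ (Path-toFront t xs ys) (Path-∷ t q) , (begin
      length xs + m                              ≤⟨ +-monoʳ-≤ (length xs) m≤ ⟩
      length xs + suc (inversions (xs ++ ys) T)  ≡⟨ +-suc _ _ ⟩
      suc (length xs + inversions (xs ++ ys) T)  ≡⟨ cong suc (inversions-toFront t T xs ys (All-resp-↭ (↭-sym rest↭T) t∉T)) ⟨
      suc (inversions (xs ++ t ∷ ys) (t ∷ T))    ∎)

  module _ (a : X) where

    _∖a : List X → List X
    R ∖a = remove _≟_ a R

    remove-++ : ∀ xs ys → (xs ++ ys) ∖a ≡ xs ∖a ++ ys ∖a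
    remove-++ = filter-++ (λ x → ¬? (x ≟ a))

    remove-keep : ∀ {x} R → x ≢ a → (x ∷ R) ∖a ≡ x ∷ R ∖a
    remove-keep R x≢a = filter-accept (λ x → ¬? (x ≟ a)) x≢a

    remove-skip : ∀ R → (a ∷ R) ∖a ≡ R ∖a
    remove-skip R = filter-reject (λ x → ¬? (x ≟ a)) (λ a≢a → a≢a refl)

    remove-pair : ∀ xs {x y} ys → x ≢ a → y ≢ a → (xs ++ x ∷ y ∷ ys) ∖a ≡ xs ∖a ++ x ∷ y ∷ ys ∖a
    remove-pair xs {x} {y} ys x≢a y≢a = begin
      (xs ++ x ∷ y ∷ ys) ∖a     ≡⟨ remove-++ xs (x ∷ y ∷ ys) ⟩
      xs ∖a ++ (x ∷ y ∷ ys) ∖a  ≡⟨ cong (xs ∖a ++_) (trans (remove-keep _ x≢a) (cong (x ∷_) (remove-keep ys y≢a))) ⟩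
      xs ∖a ++ x ∷ y ∷ ys ∖a    ∎
      where open ≡-Reasoning

    remove-swap-a : ∀ xs y ys → (xs ++ a ∷ y ∷ ys) ∖a ≡ (xs ++ y ∷ a ∷ ys) ∖a
    remove-swap-a xs y ys = begin
      (xs ++ a ∷ y ∷ ys) ∖a     ≡⟨ remove-++ xs (a ∷ y ∷ ys) ⟩
      xs ∖a ++ (a ∷ y ∷ ys) ∖a  ≡⟨ cong (xs ∖a ++_) (around-a (y ≟ a)) ⟩
      xs ∖a ++ (y ∷ a ∷ ys) ∖a  ≡⟨ remove-++ xs (y ∷ a ∷ ys) ⟨
      (xs ++ y ∷ a ∷ ys) ∖a     ∎
      where
      open ≡-Reasoning
      around-a : Dec (y ≡ a) → (a ∷ y ∷ ys) ∖a ≡ (y ∷ a ∷ ys) ∖a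
      around-a (yes refl) = refl
      around-a (no y≢a)   = begin
        (a ∷ y ∷ ys) ∖a  ≡⟨ remove-skip (y ∷ ys) ⟩
        (y ∷ ys) ∖a      ≡⟨ remove-keep ys y≢a ⟩
        y ∷ ys ∖a        ≡⟨ cong (y ∷_) (remove-skip ys) ⟨
        y ∷ (a ∷ ys) ∖a  ≡⟨ remove-keep (a ∷ ys) y≢a ⟨
        (y ∷ a ∷ ys) ∖a  ∎

    precedes-remove : ∀ T {x y} → x ≢ a → y ≢ a → precedes (T ∖a) x y ≡ precedes T x y
    precedes-remove []      x≢a y≢a = refl
    precedes-remove (z ∷ T) {x} {y} x≢a y≢a with z ≟ a
    ... | yes refl = trans (precedes-remove T x≢a y≢a) (sym (precedes-∷ T (x≢a ∘ sym) (y≢a ∘ sym)))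
    ... | no _ with z ≟ y
    ...   | yes _ = refl
    ...   | no _ with z ≟ x
    ...     | yes _ = refl
    ...     | no _  = precedes-remove T x≢a y≢a

    inversions-remove-swap : ∀ T xs {x y} ys → x ≢ a → y ≢ a →
      inversions ((xs ++ x ∷ y ∷ ys) ∖a) (T ∖a) + precedes T x y ≡ inversions ((xs ++ y ∷ x ∷ ys) ∖a) (T ∖a) + precedes T y x
    inversions-remove-swap T xs {x} {y} ys x≢a y≢a = begin
      inversions ((xs ++ x ∷ y ∷ ys) ∖a) (T ∖a) + precedes T x y
        ≡⟨ cong₂ _+_ (cong (λ L → inversions L (T ∖a)) (remove-pair xs ys x≢a y≢a)) (sym (precedes-remove T x≢a y≢a)) ⟩
      inversions (xs ∖a ++ x ∷ y ∷ ys ∖a) (T ∖a) + precedes (T ∖a) x y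
        ≡⟨ inversions-swap (T ∖a) (xs ∖a) x y (ys ∖a) ⟩
      inversions (xs ∖a ++ y ∷ x ∷ ys ∖a) (T ∖a) + precedes (T ∖a) y x
        ≡⟨ cong₂ _+_ (cong (λ L → inversions L (T ∖a)) (remove-pair xs ys y≢a x≢a)) (sym (precedes-remove T y≢a x≢a)) ⟨
      inversions ((xs ++ y ∷ x ∷ ys) ∖a) (T ∖a) + precedes T y x ∎
      where open ≡-Reasoning

    -- k′ - d(R ∖a, T ∖a) ≤ k - d(R, T), rearranged to avoid truncated subtraction.
    RestrictedPath : (List X → Set) → List X → List X → ℕ → Set
    RestrictedPath D R T k =
      ∃ λ k′ → Path (Restrict _≟_ a D) (R ∖a) (T ∖a) k′ × k′ + inversions R T ≤ k + inversions (R ∖a) (T ∖a)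

    RestrictedPath-skip : ∀ {D} → R ∖a ≡ S ∖a → Alike R S → RestrictedPath D S T k → RestrictedPath D R T (suc k)
    RestrictedPath-skip {R} {S} {T} {k} R≡S R~S (k′ , q , bound) rewrite R≡S = k′ , q , (begin
      k′ + inversions R T               ≤⟨ +-monoʳ-≤ k′ (inversions-alike T R~S) ⟩
      k′ + suc (inversions S T)         ≡⟨ +-suc k′ _ ⟩
      suc (k′ + inversions S T)         ≤⟨ s≤s bound ⟩
      suc k + inversions (S ∖a) (T ∖a)  ∎)
      where open ≤-Reasoning

    RestrictedPath-keep : ∀ {D} xs {x y} ys → x ≢ a → y ≢ a → D (xs ++ x ∷ y ∷ ys) →
      RestrictedPath D (xs ++ y ∷ x ∷ ys) T k → RestrictedPath D (xs ++ x ∷ y ∷ ys) T (suc k)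
    RestrictedPath-keep {T} {k} xs {x} {y} ys x≢a y≢a dR (k′ , q , bound) =
      suc k′ , step (_ , dR , refl) (xs ∖a , x , y , ys ∖a , remove-pair xs ys x≢a y≢a , remove-pair xs ys y≢a x≢a) q ,
      s≤s (+-cancelʳ-≤ (precedes T x y) _ _ (begin
        k′ + I + precedes T x y    ≡⟨ +-assoc k′ I _ ⟩
        k′ + (I + precedes T x y)  ≡⟨ cong (k′ +_) (inversions-swap T xs x y ys) ⟩
        k′ + (J + precedes T y x)  ≡⟨ +-assoc k′ J _ ⟨
        k′ + J + precedes T y x    ≤⟨ +-monoˡ-≤ _ bound ⟩
        k + j + precedes T y x     ≡⟨ +-assoc k j _ ⟩
        k + (j + precedes T y x)   ≡⟨ cong (k +_) (inversions-remove-swap T xs ys x≢a y≢a) ⟨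
        k + (i + precedes T x y)   ≡⟨ +-assoc k i _ ⟨
        k + i + precedes T x y     ∎))
      where
      open ≤-Reasoning
      I J i j : ℕ
      I = inversions (xs ++ x ∷ y ∷ ys) T
      J = inversions (xs ++ y ∷ x ∷ ys) T
      i = inversions ((xs ++ x ∷ y ∷ ys) ∖a) (T ∖a)
      j = inversions ((xs ++ y ∷ x ∷ ys) ∖a) (T ∖a)

    restrict-path : ∀ {D} → Unique T → Path D R T k → RestrictedPath D R T k
    restrict-path {T} uT (here dT) rewrite inversions-self≡0 uT = 1 , here (T , dT , refl) , s≤s z≤n
    restrict-path uT (step dR R~S@(xs , x , y , ys , refl , refl) p) with x ≟ a | y ≟ a
    ... | yes refl | _        = RestrictedPath-skip (remove-swap-a xs y ys) R~S (restrict-path uT p)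
    ... | no _     | yes refl = RestrictedPath-skip (sym (remove-swap-a xs x ys)) R~S (restrict-path uT p)
    ... | no x≢a   | no y≢a   = RestrictedPath-keep xs ys x≢a y≢a dR (restrict-path uT p)

  domain-unique : ∀ {A D} → Unique A → IsDomain A D → D T → Unique T
  domain-unique uA dom dT = Unique-resp-↭ (↭⇒↭ₛ (↭-sym (dom _ dT))) uA
    where open import Data.List.Relation.Binary.Permutation.Setoid.Properties (setoid X) using (Unique-resp-↭)

  Restrict-connected : ∀ {A D} a → Unique A → IsDomain A D → Connected D → Connected (Restrict _≟_ a D)
  Restrict-connected a uA dom connected _ _ (R , dR , refl) (T , dT , refl) =
    let (k , p)      = connected R T dR dT
        (k′ , q , _) = restrict-path a (domain-unique uA dom dT) p
    in k′ , q

  Restrict-directlyConnected : ∀ {A D} a → Unique A → IsDomain A D →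
    DirectlyConnected A D → DirectlyConnected (remove _≟_ a A) (Restrict _≟_ a D)
  Restrict-directlyConnected a uA dom directly _ _ (R , dR , refl) (T , dT , refl) =
    let uT                  = domain-unique uA dom dT
        (k , p , minimal)   = directly R T dR dT
        (kb , b , kb≤)      = bubble-sort uT (↭-trans (dom R dR) (↭-sym (dom T dT)))
        (k′ , q , k′-bound) = restrict-path a uT p
        k≤                  = ≤-trans (minimal kb (Path-within-LinOrd (dom R dR) b)) kb≤
    in k′ , q , λ k″ q″ → ≤-trans (cancel k′-bound k≤) (Path-length≥ (filter⁺ (λ x → ¬? (x ≟ a)) uT) q″)
    where
    cancel : ∀ {k′ k I i} → k′ + I ≤ k + i → k ≤ suc I → k′ ≤ suc i
    cancel {k′} {k} {I} {i} k′+I≤k+i k≤1+I = +-cancelʳ-≤ I _ _ (begin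
      k′ + I     ≤⟨ k′+I≤k+i ⟩
      k + i      ≤⟨ +-monoˡ-≤ i k≤1+I ⟩
      suc I + i  ≡⟨ cong suc (+-comm I i) ⟩
      suc i + I  ∎)
      where open ≤-Reasoning

lemma3 : {X : Set} (_≟_ : DecidableEquality X) (A : List X) → Unique A → 4 ≤ length A →
    (D : List X → Set) → IsDomain A D → (a : X) → a ∈ A →
    (Connected D → Connected (Restrict _≟_ a D))
    × (DirectlyConnected A D → DirectlyConnected (remove _≟_ a A) (Restrict _≟_ a D))
lemma3 _≟_ A uA _ D dom a _ = Restrict-connected _≟_ a uA dom , Restrict-directlyConnected _≟_ a uA dom
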